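{- Let $r\ge 2$ and let $l_1,l_2,\dots,l_r$ and $t$ be positive integers such that $l=\min(l_1,l_2,\dots,l_r)\geq t+2$. Then there exists a constant $n_0=n_0(l_1,l_2,\dots,l_r,t)$ depending only on $l_1,\dots,l_r$ and $t$ such that the following holds for all $n_1,\dots,n_r\geq n_0$: if families $\mathcal A_j\subseteq P(n_j,l_j)$ ($j=1,2,\dots,r$) are $r$-cross $t$-intersecting, then \[ \prod_{j=1}^r |\mathcal A_j|\leq \prod_{j=1}^r \binom{n_j+l_j-t-1}{l_j-t-1}. \] Moreover, equality holds if and only if there is a $t$-element subset $T$ of $\{1,2,\dots,l\}$ such that $\mathcal A_j=\{\mathbf u\in P(n_j,l_j) : \mathbf u(i)=0 \text{ for all } i\in T\}$ for every $j=1,2,\dots,r$.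
   Context: $\mathbb N_0$ denotes the set of non-negative integers. For positive integers $n,l$, $P(n,l)=\{(x_1,\dots,x_l)\in\mathbb N_0^l : x_1+\cdots+x_l=n\}$ is the set of weak compositions of $n$ with $l$ parts; for $\mathbf u=(u_1,\dots,u_l)\in P(n,l)$, $\mathbf u(i)=u_i$ denotes its $i$-th coordinate. Given $\mathbf u_j\in P(n_j,l_j)$ for $j=1,\dots,r$ and $l=\min(l_1,\dots,l_r)$, let $I(\mathbf u_1,\dots,\mathbf u_r)=\{i\in\{1,\dots,l\} : \mathbf u_1(i)=\mathbf u_2(i)=\cdots=\mathbf u_r(i)\}$. Families $\mathcal A_j\subseteq P(n_j,l_j)$ ($j=1,\dots,r$) are $r$-cross $t$-intersecting if $|I(\mathbf u_1,\dots,\mathbf u_r)|\ge t$ for all choices $\mathbf u_j\in\mathcal A_j$, $j=1,\dots,r$. -}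

module Defs where

open import Data.Nat using (ℕ; zero; suc; _⊓_; _*_; _≟_)
open import Data.Fin using (Fin) renaming (zero to fzero; suc to fsuc)
open import Data.Fin.Properties using (all?)
open import Data.Vec using (Vec; []; _∷_)
open import Data.List using (List; length; filter; upTo)
open import Relation.Binary.PropositionalEquality using (_≡_)
open import Relation.Nullary using (Dec)
open import Function using (_∘_)

-- 0-based coordinate access (coordinate i of the paper is  at u (i - 1));
-- out-of-range indices give 0, but they are never used (i < min l_j).
at : ∀ {k} → Vec ℕ k → ℕ → ℕ
at []       _       = 0
at (x ∷ xs) zero    = x
at (x ∷ xs) (suc i) = at xs i

-- min over a nonempty finite family (value 0 for r = 0, never used since r ≥ 2)
minF : (r : ℕ) → (Fin r → ℕ) → ℕ
minF zero          f = 0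
minF (suc zero)    f = f fzero
minF (suc (suc r)) f = f fzero ⊓ minF (suc r) (f ∘ fsuc)

prodF : (r : ℕ) → (Fin r → ℕ) → ℕ
prodF zero    f = 1
prodF (suc r) f = f fzero * prodF r (f ∘ fsuc)

Agree : (r : ℕ) (ls : Fin r → ℕ) → ((j : Fin r) → Vec ℕ (ls j)) → ℕ → Set
Agree r ls u i = ∀ j j′ → at (u j) i ≡ at (u j′) i

agree? : (r : ℕ) (ls : Fin r → ℕ) (u : (j : Fin r) → Vec ℕ (ls j)) (i : ℕ) → Dec (Agree r ls u i)
agree? r ls u i = all? (λ j → all? (λ j′ → at (u j) i ≟ at (u j′) i))

cardI : (r : ℕ) (ls : Fin r → ℕ) → ((j : Fin r) → Vec ℕ (ls j)) → ℕ
cardI r ls u = length (filter (agree? r ls u) (upTo (minF r ls)))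

-- Write ∣P∣ n k for |P(n,k)| = C(n+k−1, k−1). A family B has a kernel at b0 ∈ B if all members of B agree
-- with b0 on some t-set S of the first l coordinates. If every A_j has a kernel S_j, then A_j lies among
-- the compositions pinned on S_j, so |A_j| ≤ ∣P∣ n_j (l_j − t), with equality only if the pinned values
-- are 0 and A_j is everything vanishing on S_j; distinct S_j, S_k are then excluded by a pair of such
-- compositions agreeing in fewer than t places. If A_k has no kernel at b0, a member of another family
-- agrees with b0 on a t-set S and with a member of A_k that breaks S at one further coordinate, so
-- |A_j| ≤ 2^l·l·∣P∣ n_j (l_j − t − 1), while |A_k| ≤ 2^l·∣P∣ n_k (l_k − t); since ∣P∣ n (k+1) / ∣P∣ n k
-- grows linearly in n, the product falls strictly below the bound once all n_j ≥ n₀.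

module Submission where

open import Defs
open import Data.Nat
open import Data.Nat.Properties
open import Data.Nat.Combinatorics using (_C_; nCn≡1; nCk+nC[k+1]≡[n+1]C[k+1])
open import Data.Bool using (Bool; true; false; not; if_then_else_; _∧_; _∨_)
import Data.Bool as Bool
open import Data.Bool.Properties using (∨-identityʳ; ¬-not; T-≡)
open import Data.Vec using (Vec; []; _∷_; sum; here; there)
open import Data.Vec.Properties using (∷-injectiveˡ; ∷-injectiveʳ)
import Data.Vec.Properties as Vec
open import Data.Fin using (Fin; toℕ; fromℕ<) renaming (zero to fzero; suc to fsuc)
open import Data.Fin.Properties using (toℕ-fromℕ<) renaming (_≟_ to _≟ᶠ_)
open import Data.Fin.Subset using (Subset; ∣_∣) renaming (_∈_ to _∈ₛ_)
open import Data.List using (List; []; _∷_; map; _++_; length; filter; applyUpTo; upTo; concatMap)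
open import Data.List.Properties using (length-map; length-++; length-filter; length-upTo)
open import Data.List.Membership.Propositional using (_∈_; find; lose)
open import Data.List.Membership.Propositional.Properties
  using (∈-map⁺; ∈-map⁻; ∈-++⁺ˡ; ∈-++⁺ʳ; ∈-++⁻; ∈-∃++; ∈-filter⁺; ∈-filter⁻; ∈-upTo⁺; ∈-upTo⁻; ∈-concatMap⁺)
import Data.List.Membership.DecPropositional as DecMembership
open import Data.List.Relation.Binary.Subset.Propositional using (_⊆_)
open import Data.List.Relation.Unary.Any using (here; there; any?)
open import Data.List.Relation.Unary.All using (All; []; _∷_; all?)
import Data.List.Relation.Unary.All as All
open import Data.List.Relation.Unary.All.Properties.Core using (¬Any⇒All¬; ¬All⇒Any¬)
open import Data.List.Relation.Unary.AllPairs using ([]; _∷_)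
open import Data.List.Relation.Unary.Unique.Propositional using (Unique)
import Data.List.Relation.Unary.Unique.Propositional.Properties as Unique
open import Data.Sum using (_⊎_; inj₁; inj₂)
open import Data.Product using (Σ; ∃; _×_; _,_; proj₁; proj₂)
open import Data.Product.Function.NonDependent.Propositional using (_×-⇔_)
open import Data.Empty using (⊥-elim)
open import Function using (_∘_)
open import Function.Bundles using (_⇔_; mk⇔; Equivalence)
open import Function.Construct.Identity using (⇔-id)
open import Function.Construct.Composition using (_⇔-∘_)
open import Function.Construct.Symmetry using (⇔-sym)
open import Relation.Nullary using (Dec; yes; no; ¬_; does; contradiction)
open import Relation.Nullary.Decidable using (map′; _→-dec_; _×-dec_)
open import Relation.Unary using (Decidable)
open import Relation.Binary.Definitions using (DecidableEquality)
open import Relation.Binary.PropositionalEquality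
open import Algebra.Properties.CommutativeSemigroup +-commutativeSemigroup using (x∙yz≈y∙xz)

Unique∧⊆⇒length≤ : ∀ {A : Set} {xs ys : List A} → Unique xs → xs ⊆ ys → length xs ≤ length ys
Unique∧⊆⇒length≤ {xs = []}     _          _     = z≤n
Unique∧⊆⇒length≤ {xs = x ∷ xs} (x∉ ∷ xs!) xs⊆ys with ∈-∃++ (xs⊆ys (here refl))
... | ys₁ , ys₂ , refl = begin
  suc (length xs)               ≤⟨ s≤s (Unique∧⊆⇒length≤ xs! xs⊆ys₁++ys₂) ⟩
  suc (length (ys₁ ++ ys₂))     ≡⟨ cong suc (length-++ ys₁) ⟩
  suc (length ys₁ + length ys₂) ≡⟨ +-suc (length ys₁) (length ys₂) ⟨
  length ys₁ + suc (length ys₂) ≡⟨ length-++ ys₁ ⟨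
  length (ys₁ ++ x ∷ ys₂)       ∎
  where
  open ≤-Reasoning
  xs⊆ys₁++ys₂ : xs ⊆ ys₁ ++ ys₂
  xs⊆ys₁++ys₂ {z} z∈xs with ∈-++⁻ ys₁ (xs⊆ys (there z∈xs))
  ... | inj₁ z∈ys₁         = ∈-++⁺ˡ z∈ys₁
  ... | inj₂ (here z≡x)    = ⊥-elim (All.lookup x∉ z∈xs (sym z≡x))
  ... | inj₂ (there z∈ys₂) = ∈-++⁺ʳ ys₁ z∈ys₂

Unique∧⊆∧length≥⇒⊇ : ∀ {A : Set} → DecidableEquality A → {xs ys : List A} →
                      Unique xs → xs ⊆ ys → length ys ≤ length xs → ys ⊆ xs
Unique∧⊆∧length≥⇒⊇ _≟_ {xs} {ys} xs! xs⊆ys ys≤xs {y} y∈ys with DecMembership._∈?_ _≟_ y xs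
... | yes y∈xs = y∈xs
... | no  y∉xs = ⊥-elim (<⇒≱ (Unique∧⊆⇒length≤ (¬Any⇒All¬ xs y∉xs ∷ xs!) y∷xs⊆ys) ys≤xs)
  where
  y∷xs⊆ys : y ∷ xs ⊆ ys
  y∷xs⊆ys (here refl) = y∈ys
  y∷xs⊆ys (there z∈)  = xs⊆ys z∈

length-concatMap≤ : ∀ {A B : Set} (f : A → List B) (xs : List A) c → (∀ x → x ∈ xs → length (f x) ≤ c) →
                    length (concatMap f xs) ≤ length xs * c
length-concatMap≤ f []       c _  = z≤n
length-concatMap≤ f (x ∷ xs) c ≤c =
  ≤-trans (≤-reflexive (length-++ (f x))) (+-mono-≤ (≤c x (here refl)) (length-concatMap≤ f xs c (λ y → ≤c y ∘ there)))

∈-concatMap : ∀ {A B : Set} (f : A → List B) {x xs y} → x ∈ xs → y ∈ f x → y ∈ concatMap f xs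
∈-concatMap f x∈ y∈ = ∈-concatMap⁺ f (lose x∈ y∈)

does≡true⇒ : ∀ {P : Set} (P? : Dec P) → does P? ≡ true → P
does≡true⇒ (yes p) _ = p

false≢true : false ≢ true
false≢true ()

≡ᵇ≡true⇒≡ : ∀ m n → (m ≡ᵇ n) ≡ true → m ≡ n
≡ᵇ≡true⇒≡ m n m≡ᵇn = ≡ᵇ⇒≡ m n (Equivalence.from T-≡ m≡ᵇn)

≡ᵇ-refl : ∀ n → (n ≡ᵇ n) ≡ true
≡ᵇ-refl n = Equivalence.to T-≡ (≡⇒≡ᵇ n n refl)

-- Weak compositions

sum≤ : (ℕ → ℕ) → ℕ → ℕ
sum≤ h zero    = h zero
sum≤ h (suc n) = sum≤ h n + h (suc n)

sum≤-cong : ∀ {h h′} → (∀ y → h y ≡ h′ y) → ∀ n → sum≤ h n ≡ sum≤ h′ n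
sum≤-cong h≗h′ zero    = h≗h′ zero
sum≤-cong h≗h′ (suc n) = cong₂ _+_ (sum≤-cong h≗h′ n) (h≗h′ (suc n))

-- split off the first coordinate, n ∸ y
∣P∣ : ℕ → ℕ → ℕ
∣P∣ n       (suc k) = sum≤ (λ y → ∣P∣ y k) n
∣P∣ zero    zero    = 1
∣P∣ (suc n) zero    = 0

∣P∣-zero : ∀ k → ∣P∣ 0 k ≡ 1
∣P∣-zero zero    = refl
∣P∣-zero (suc k) = ∣P∣-zero k

∣P∣-one : ∀ n → ∣P∣ n 1 ≡ 1
∣P∣-one zero    = refl
∣P∣-one (suc n) = trans (+-identityʳ (∣P∣ n 1)) (∣P∣-one n)

∣P∣-positive : ∀ n k → 1 ≤ ∣P∣ n (suc k)
∣P∣-positive zero    k = ≤-reflexive (sym (∣P∣-zero (suc k)))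
∣P∣-positive (suc n) k = ≤-trans (∣P∣-positive n k) (m≤m+n _ _)

∣P∣-mono-≤ : ∀ k {m n} → m ≤ n → ∣P∣ m (suc k) ≤ ∣P∣ n (suc k)
∣P∣-mono-≤ k {n = zero}  z≤n = ≤-refl
∣P∣-mono-≤ k {n = suc n} m≤1+n with m≤n⇒m<n∨m≡n m≤1+n
... | inj₁ (s≤s m≤n) = ≤-trans (∣P∣-mono-≤ k m≤n) (m≤m+n _ _)
... | inj₂ refl      = ≤-refl

∣P∣-mono-< : ∀ k {m n} → m < n → ∣P∣ m (2 + k) < ∣P∣ n (2 + k)
∣P∣-mono-< k {m} m<n = <-≤-trans step (∣P∣-mono-≤ (suc k) m<n)
  where
  step : ∣P∣ m (2 + k) < ∣P∣ (suc m) (2 + k)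
  step = subst (_< ∣P∣ (suc m) (2 + k)) (+-identityʳ _)
           (+-monoʳ-< (∣P∣ m (2 + k)) (∣P∣-positive (suc m) k))

k*P[n,1+k]≡[n+k]*P[n,k] : ∀ n k → k * ∣P∣ n (suc k) ≡ (n + k) * ∣P∣ n k
[1+n]*P[1+n,1+k]≡[1+n+k]*P[n,1+k] : ∀ n k → suc n * ∣P∣ (suc n) (suc k) ≡ (suc n + k) * ∣P∣ n (suc k)

k*P[n,1+k]≡[n+k]*P[n,k] zero k = cong (k *_) (trans (∣P∣-zero (suc k)) (sym (∣P∣-zero k)))
k*P[n,1+k]≡[n+k]*P[n,k] (suc n) zero = sym (*-zeroʳ (suc n + 0))
k*P[n,1+k]≡[n+k]*P[n,k] (suc n) (suc k) = begin
  suc k * (A + B)                         ≡⟨ *-distribˡ-+ (suc k) A B ⟩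
  suc k * A + suc k * B                   ≡⟨ cong (_+ suc k * B) (k*P[n,1+k]≡[n+k]*P[n,k] n (suc k)) ⟩
  (n + suc k) * ∣P∣ n (suc k) + suc k * B  ≡⟨ cong (λ m → m * ∣P∣ n (suc k) + suc k * B) (+-suc n k) ⟩
  (suc n + k) * ∣P∣ n (suc k) + suc k * B  ≡⟨ cong (_+ suc k * B) (sym ([1+n]*P[1+n,1+k]≡[1+n+k]*P[n,1+k] n k)) ⟩
  suc n * B + suc k * B                   ≡⟨ *-distribʳ-+ B (suc n) (suc k) ⟨
  (suc n + suc k) * B                     ∎
  where
  open ≡-Reasoning
  A = ∣P∣ n (2 + k)
  B = ∣P∣ (suc n) (suc k)

[1+n]*P[1+n,1+k]≡[1+n+k]*P[n,1+k] n zero =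
  trans (cong (suc n *_) (∣P∣-one (suc n)))
        (cong₂ _*_ (sym (+-identityʳ (suc n))) (sym (∣P∣-one n)))
[1+n]*P[1+n,1+k]≡[1+n+k]*P[n,1+k] n (suc k) = begin
  suc n * (A + B)                         ≡⟨ *-distribˡ-+ (suc n) A B ⟩
  suc n * A + suc n * B                   ≡⟨ cong (suc n * A +_) ([1+n]*P[1+n,1+k]≡[1+n+k]*P[n,1+k] n k) ⟩
  suc n * A + (suc n + k) * ∣P∣ n (suc k)  ≡⟨ cong (λ m → suc n * A + m * ∣P∣ n (suc k)) (+-suc n k) ⟨
  suc n * A + (n + suc k) * ∣P∣ n (suc k)  ≡⟨ cong (suc n * A +_) (k*P[n,1+k]≡[n+k]*P[n,k] n (suc k)) ⟨
  suc n * A + suc k * A                   ≡⟨ *-distribʳ-+ A (suc n) (suc k) ⟨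
  (suc n + suc k) * A                     ∎
  where
  open ≡-Reasoning
  A = ∣P∣ n (2 + k)
  B = ∣P∣ (suc n) (suc k)

M*P[n,1+k]<P[n,2+k] : ∀ M n k → suc k * M ≤ n → M * ∣P∣ n (suc k) < ∣P∣ n (2 + k)
M*P[n,1+k]<P[n,2+k] M n k [1+k]M≤n = *-cancelˡ-< (suc k) (M * G) (∣P∣ n (2 + k)) (begin-strict
  suc k * (M * G)        ≡⟨ *-assoc (suc k) M G ⟨
  suc k * M * G          ≤⟨ *-monoˡ-≤ G [1+k]M≤n ⟩
  n * G                  <⟨ *-monoˡ-< G (m<m+n n z<s) ⟩
  (n + suc k) * G        ≡⟨ k*P[n,1+k]≡[n+k]*P[n,k] n (suc k) ⟨
  suc k * ∣P∣ n (2 + k)   ∎)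
  where
  open ≤-Reasoning
  G = ∣P∣ n (suc k)
  instance
    G≢0 : NonZero G
    G≢0 = >-nonZero (∣P∣-positive n k)

∣P∣≡C : ∀ n k → ∣P∣ n (suc k) ≡ (n + k) C k
∣P∣≡C n       zero    = ∣P∣-one n
∣P∣≡C zero    (suc k) = trans (∣P∣-zero (2 + k)) (sym (nCn≡1 (suc k)))
∣P∣≡C (suc n) (suc k) = begin
  ∣P∣ n (2 + k) + ∣P∣ (suc n) (suc k)         ≡⟨ cong₂ _+_ (∣P∣≡C n (suc k)) (∣P∣≡C (suc n) k) ⟩
  (n + suc k) C suc k + (suc n + k) C k      ≡⟨ cong (λ m → m C suc k + (suc n + k) C k) (+-suc n k) ⟩
  (suc n + k) C suc k + (suc n + k) C k      ≡⟨ +-comm ((suc n + k) C suc k) _ ⟩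
  (suc n + k) C k + (suc n + k) C suc k      ≡⟨ nCk+nC[k+1]≡[n+1]C[k+1] (suc n + k) k ⟩
  suc (suc n + k) C suc k                    ≡⟨ cong (_C suc k) (+-suc (suc n) k) ⟨
  (suc n + suc k) C suc k                    ∎
  where open ≡-Reasoning

-- Sets of coordinates are Boolean predicates on ℕ.
count : ℕ → (ℕ → Bool) → ℕ
count zero    P = 0
count (suc l) P = (if P 0 then 1 else 0) + count l (P ∘ suc)

count-cong : ∀ l {P Q} → (∀ i → i < l → P i ≡ Q i) → count l P ≡ count l Q
count-cong zero    P≗Q = refl
count-cong (suc l) P≗Q =
  cong₂ _+_ (cong (λ b → if b then 1 else 0) (P≗Q 0 z<s)) (count-cong l (λ i i<l → P≗Q (suc i) (s≤s i<l)))

count-mono : ∀ l {P Q} → (∀ i → i < l → P i ≡ true → Q i ≡ true) → count l P ≤ count l Q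
count-mono zero    P⊆Q = z≤n
count-mono (suc l) {P} {Q} P⊆Q with P 0 in P0 | Q 0 in Q0
... | true  | true  = s≤s (count-mono l (λ i i<l → P⊆Q (suc i) (s≤s i<l)))
... | true  | false = ⊥-elim (false≢true (trans (sym Q0) (P⊆Q 0 z<s P0)))
... | false | true  = m≤n⇒m≤1+n (count-mono l (λ i i<l → P⊆Q (suc i) (s≤s i<l)))
... | false | false = count-mono l (λ i i<l → P⊆Q (suc i) (s≤s i<l))

count-mono-< : ∀ l {P Q} → (∀ i → i < l → P i ≡ true → Q i ≡ true) →
               ∀ j → j < l → Q j ≡ true → P j ≡ false → count l P < count l Q
count-mono-< (suc l) {P} {Q} P⊆Q zero _ Q0 P0 rewrite Q0 | P0 =
  s≤s (count-mono l (λ i i<l → P⊆Q (suc i) (s≤s i<l)))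
count-mono-< (suc l) {P} {Q} P⊆Q (suc j) (s≤s j<l) Qj Pj with P 0 in P0 | Q 0 in Q0
... | true  | true  = s≤s (count-mono-< l (λ i i<l → P⊆Q (suc i) (s≤s i<l)) j j<l Qj Pj)
... | true  | false = ⊥-elim (false≢true (trans (sym Q0) (P⊆Q 0 z<s P0)))
... | false | true  = m≤n⇒m≤1+n (count-mono-< l (λ i i<l → P⊆Q (suc i) (s≤s i<l)) j j<l Qj Pj)
... | false | false = count-mono-< l (λ i i<l → P⊆Q (suc i) (s≤s i<l)) j j<l Qj Pj

⊆∧count-≥⇒⊇ : ∀ l {P Q} → (∀ i → i < l → P i ≡ true → Q i ≡ true) → count l Q ≤ count l P →
              ∀ i → i < l → Q i ≡ true → P i ≡ true
⊆∧count-≥⇒⊇ l {P} P⊆Q Q≤P i i<l Qi with P i in Pi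
... | true  = refl
... | false = ⊥-elim (<⇒≱ (count-mono-< l P⊆Q i i<l Qi Pi) Q≤P)

count-complement : ∀ l P → count l P + count l (not ∘ P) ≡ l
count-complement zero    P = refl
count-complement (suc l) P with P 0
... | true  = cong suc (count-complement l (P ∘ suc))
... | false = trans (+-suc _ _) (cong suc (count-complement l (P ∘ suc)))

count-beyond : ∀ l p P → l ≤ p → (∀ i → l ≤ i → P i ≡ false) → count p P ≡ count l P
count-beyond zero    zero    P _ P≥l = refl
count-beyond zero    (suc p) P _ P≥l rewrite P≥l 0 z≤n =
  count-beyond zero p (P ∘ suc) z≤n (λ i _ → P≥l (suc i) z≤n)
count-beyond (suc l) (suc p) P (s≤s l≤p) P≥l =
  cong (_ +_) (count-beyond l p (P ∘ suc) l≤p (λ i l≤i → P≥l (suc i) (s≤s l≤i)))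

count-insert : ∀ p P i → i < p → P i ≡ false → count p (λ x → P x ∨ (x ≡ᵇ i)) ≡ suc (count p P)
count-insert (suc p) P zero _ P0 rewrite P0 = cong suc (count-cong p (λ j _ → ∨-identityʳ (P (suc j))))
count-insert (suc p) P (suc i) (s≤s i<p) Pi with P 0
... | true  = cong suc (count-insert p (P ∘ suc) i i<p Pi)
... | false = count-insert p (P ∘ suc) i i<p Pi

length-filter-applyUpTo : ∀ {P : ℕ → Set} (P? : Decidable P) (f : ℕ → ℕ) l →
                          length (filter P? (applyUpTo f l)) ≡ count l (λ i → does (P? (f i)))
length-filter-applyUpTo P? f zero = refl
length-filter-applyUpTo P? f (suc l) with does (P? (f 0))
... | true  = cong suc (length-filter-applyUpTo P? (f ∘ suc) l)
... | false = length-filter-applyUpTo P? (f ∘ suc) l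

-- Compositions with pinned coordinates

Pinned : (p : ℕ) → (ℕ → Bool) → (ℕ → ℕ) → Vec ℕ p → Set
Pinned p S f u = ∀ i → i < p → S i ≡ true → at u i ≡ f i

pinnedSum : ℕ → (ℕ → Bool) → (ℕ → ℕ) → ℕ
pinnedSum zero    S f = 0
pinnedSum (suc p) S f = (if S 0 then f 0 else 0) + pinnedSum p (S ∘ suc) (f ∘ suc)

free : ℕ → (ℕ → Bool) → ℕ
free p S = count p (not ∘ S)

-- the number of ways to fill F free coordinates when the pinned ones already use σ of n
completions : ℕ → ℕ → ℕ → ℕ
completions n σ F with σ ≤? n
... | yes _ = ∣P∣ (n ∸ σ) F
... | no  _ = 0

prefixed : ∀ {p} → (ℕ → List (Vec ℕ p)) → ℕ → ℕ → List (Vec ℕ (suc p))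
prefixed E n zero    = map (n ∷_) (E 0)
prefixed E n (suc k) = prefixed E n k ++ map ((n ∸ suc k) ∷_) (E (suc k))

prefixedPinned : ∀ {p} → (c n : ℕ) → Dec (c ≤ n) → (ℕ → List (Vec ℕ p)) → List (Vec ℕ (suc p))
prefixedPinned c n (yes _) E = map (c ∷_) (E (n ∸ c))
prefixedPinned c n (no _)  E = []

extend : ∀ {p} → Bool → (c n : ℕ) → (ℕ → List (Vec ℕ p)) → List (Vec ℕ (suc p))
extend true  c n E = prefixedPinned c n (c ≤? n) E
extend false c n E = prefixed E n n

compositions : ℕ → (p : ℕ) → (ℕ → Bool) → (ℕ → ℕ) → List (Vec ℕ p)
compositions n       (suc p) S f = extend (S 0) (f 0) n (λ y → compositions y p (S ∘ suc) (f ∘ suc))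
compositions zero    zero    S f = [] ∷ []
compositions (suc n) zero    S f = []

length-prefixed : ∀ {p} (E : ℕ → List (Vec ℕ p)) n k → length (prefixed E n k) ≡ sum≤ (length ∘ E) k
length-prefixed E n zero    = length-map _ (E 0)
length-prefixed E n (suc k) =
  trans (length-++ (prefixed E n k)) (cong₂ _+_ (length-prefixed E n k) (length-map _ (E (suc k))))

sum≤-completions : ∀ σ F n → sum≤ (λ y → completions y σ F) n ≡ completions n σ (suc F)
sum≤-completions σ F zero with σ ≤? 0
... | yes z≤n = refl
... | no  _   = refl
sum≤-completions σ F (suc n) with σ ≤? n | sum≤-completions σ F n
... | yes σ≤n | ih with σ ≤? suc n
...   | no σ≰1+n = ⊥-elim (σ≰1+n (m≤n⇒m≤1+n σ≤n))
...   | yes _ rewrite ih | +-∸-assoc 1 σ≤n = refl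
sum≤-completions σ F (suc n) | no σ≰n | ih with σ ≤? suc n
...   | no  _     rewrite ih = refl
...   | yes σ≤1+n rewrite ih | ≤-antisym σ≤1+n (≰⇒> σ≰n) | n∸n≡0 n = refl

completions-shift : ∀ {c n} σ F → c ≤ n → completions (n ∸ c) σ F ≡ completions n (c + σ) F
completions-shift {c} {n} σ F c≤n with σ ≤? n ∸ c | c + σ ≤? n
... | yes _  | yes _  = cong (λ m → ∣P∣ m F) (∸-+-assoc n c σ)
... | yes σ≤ | no c+σ≰ = ⊥-elim (c+σ≰ (≤-trans (+-monoʳ-≤ c σ≤) (≤-reflexive (m+[n∸m]≡n c≤n))))
... | no σ≰  | yes c+σ≤ = ⊥-elim (σ≰ (subst (_≤ n ∸ c) (m+n∸m≡n c σ) (∸-monoˡ-≤ c c+σ≤)))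
... | no _   | no _   = refl

completions-overflow : ∀ {c n} σ F → ¬ c ≤ n → 0 ≡ completions n (c + σ) F
completions-overflow {c} {n} σ F c≰n with c + σ ≤? n
... | yes c+σ≤n = ⊥-elim (c≰n (≤-trans (m≤m+n c σ) c+σ≤n))
... | no  _     = refl

length-compositions : ∀ n p S f → length (compositions n p S f) ≡ completions n (pinnedSum p S f) (free p S)
length-compositions zero    zero S f = refl
length-compositions (suc n) zero S f = refl
length-compositions n (suc p) S f with S 0
... | true with f 0 ≤? n
...   | yes c≤n = trans (length-map _ (compositions (n ∸ f 0) p _ _))
                    (trans (length-compositions (n ∸ f 0) p _ _) (completions-shift _ _ c≤n))
...   | no c≰n  = completions-overflow _ _ c≰n
length-compositions n (suc p) S f | false =
  trans (length-prefixed _ n n)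
    (trans (sum≤-cong (λ y → length-compositions y p _ _) n)
      (sum≤-completions (pinnedSum p (S ∘ suc) (f ∘ suc)) (free p (S ∘ suc)) n))

∈-prefixed⁺ : ∀ {p} (E : ℕ → List (Vec ℕ p)) n {y} k {v} → y ≤ k → v ∈ E y → ((n ∸ y) ∷ v) ∈ prefixed E n k
∈-prefixed⁺ E n zero    z≤n v∈ = ∈-map⁺ _ v∈
∈-prefixed⁺ E n {y} (suc k) y≤ v∈ with y ≟ suc k
... | yes refl = ∈-++⁺ʳ (prefixed E n k) (∈-map⁺ _ v∈)
... | no  y≢   = ∈-++⁺ˡ (∈-prefixed⁺ E n k (m<1+n⇒m≤n (≤∧≢⇒< y≤ y≢)) v∈)

∈-compositions⁺ : ∀ p S f (u : Vec ℕ p) → Pinned p S f u → u ∈ compositions (sum u) p S f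
∈-compositions⁺ zero    S f [] _ = here refl
∈-compositions⁺ (suc p) S f (x ∷ u) pin with S 0 in S0
... | true with pin 0 z<s S0
...   | refl with f 0 ≤? f 0 + sum u
...     | yes _ = ∈-map⁺ _ (subst (λ m → u ∈ compositions m p _ _) (sym (m+n∸m≡n (f 0) (sum u)))
                    (∈-compositions⁺ p _ _ u (λ i i<p Si → pin (suc i) (s≤s i<p) Si)))
...     | no f0≰ = ⊥-elim (f0≰ (m≤m+n _ _))
∈-compositions⁺ (suc p) S f (x ∷ u) pin | false =
  subst (λ z → (z ∷ u) ∈ prefixed _ (x + sum u) (x + sum u)) (m+n∸n≡m x (sum u))
    (∈-prefixed⁺ _ (x + sum u) (x + sum u) (m≤n+m (sum u) x)
      (∈-compositions⁺ p _ _ u (λ i i<p Si → pin (suc i) (s≤s i<p) Si)))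

∈-prefixed⁻ : ∀ {p} (E : ℕ → List (Vec ℕ p)) n k {v} → v ∈ prefixed E n k →
              Σ ℕ λ y → y ≤ k × Σ (Vec ℕ p) λ w → w ∈ E y × v ≡ (n ∸ y) ∷ w
∈-prefixed⁻ E n zero v∈ with ∈-map⁻ _ v∈
... | w , w∈ , refl = 0 , z≤n , w , w∈ , refl
∈-prefixed⁻ E n (suc k) v∈ with ∈-++⁻ (prefixed E n k) v∈
... | inj₁ v∈′ with ∈-prefixed⁻ E n k v∈′
...   | y , y≤k , w , w∈ , v≡ = y , m≤n⇒m≤1+n y≤k , w , w∈ , v≡
∈-prefixed⁻ E n (suc k) v∈ | inj₂ v∈′ with ∈-map⁻ _ v∈′
...   | w , w∈ , refl = suc k , ≤-refl , w , w∈ , refl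

∈-compositions⁻ : ∀ n p S f {u} → u ∈ compositions n p S f → sum u ≡ n × Pinned p S f u
∈-compositions⁻ zero zero S f (here refl) = refl , λ i ()
∈-compositions⁻ n (suc p) S f u∈ with S 0 in S0
... | true with f 0 ≤? n
...   | yes f0≤n with ∈-map⁻ _ u∈
...     | v , v∈ , refl with ∈-compositions⁻ (n ∸ f 0) p _ _ v∈
...       | sum-v , pin-v = trans (cong (f 0 +_) sum-v) (m+[n∸m]≡n f0≤n) , pin
  where
  pin : Pinned (suc p) S f (f 0 ∷ v)
  pin zero    _         _  = refl
  pin (suc i) (s≤s i<p) Si = pin-v i i<p Si
∈-compositions⁻ n (suc p) S f u∈ | false with ∈-prefixed⁻ _ n n u∈
... | y , y≤n , w , w∈ , refl with ∈-compositions⁻ y p _ _ w∈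
...   | sum-w , pin-w = trans (cong ((n ∸ y) +_) sum-w) (m∸n+n≡m y≤n) , pin
  where
  pin : Pinned (suc p) S f ((n ∸ y) ∷ w)
  pin zero    _         S0′ = ⊥-elim (false≢true (trans (sym S0) S0′))
  pin (suc i) (s≤s i<p) Si  = pin-w i i<p Si

prefixed-unique : ∀ {p} (E : ℕ → List (Vec ℕ p)) n → (∀ y → Unique (E y)) → ∀ k → k ≤ n → Unique (prefixed E n k)
prefixed-unique E n U zero    _     = Unique.map⁺ ∷-injectiveʳ (U 0)
prefixed-unique E n U (suc k) 1+k≤n =
  Unique.++⁺ (prefixed-unique E n U k (<⇒≤ 1+k≤n)) (Unique.map⁺ ∷-injectiveʳ (U (suc k))) disjoint
  where
  disjoint : ∀ {v} → ¬ (v ∈ prefixed E n k × v ∈ map ((n ∸ suc k) ∷_) (E (suc k)))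
  disjoint (v∈₁ , v∈₂) with ∈-prefixed⁻ E n k v∈₁ | ∈-map⁻ _ v∈₂
  ... | y , y≤k , _ , _ , v≡ | _ , _ , v≡′ =
    <⇒≢ (∸-monoʳ-< (s≤s y≤k) 1+k≤n) (∷-injectiveˡ (trans (sym v≡′) v≡))

compositions-unique : ∀ n p S f → Unique (compositions n p S f)
compositions-unique zero    zero S f = [] ∷ []
compositions-unique (suc n) zero S f = []
compositions-unique n (suc p) S f with S 0
... | true with f 0 ≤? n
...   | yes _ = Unique.map⁺ ∷-injectiveʳ (compositions-unique (n ∸ f 0) p _ _)
...   | no  _ = []
compositions-unique n (suc p) S f | false =
  prefixed-unique _ n (λ y → compositions-unique y p _ _) n ≤-refl

completions-≤ : ∀ n σ F → completions n σ (suc F) ≤ ∣P∣ n (suc F)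
completions-≤ n σ F with σ ≤? n
... | yes _ = ∣P∣-mono-≤ F (m∸n≤m n σ)
... | no  _ = z≤n

completions-zero : ∀ n F → completions n 0 F ≡ ∣P∣ n F
completions-zero n F with 0 ≤? n
... | yes _   = refl
... | no  0≰n = ⊥-elim (0≰n z≤n)

completions-< : ∀ n σ F → 1 ≤ σ → completions n σ (2 + F) < ∣P∣ n (2 + F)
completions-< n σ F 1≤σ with σ ≤? n
... | yes σ≤n = ∣P∣-mono-< F (∸-monoʳ-< {n} {σ} {0} 1≤σ σ≤n)
... | no  _   = ∣P∣-positive n (suc F)

pinnedSum≡0⇒ : ∀ p S f → pinnedSum p S f ≡ 0 → ∀ i → i < p → S i ≡ true → f i ≡ 0
pinnedSum≡0⇒ (suc p) S f Σ≡0 zero    _         S0 rewrite S0 = m+n≡0⇒m≡0 (f 0) Σ≡0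
pinnedSum≡0⇒ (suc p) S f Σ≡0 (suc i) (s≤s i<p) Si =
  pinnedSum≡0⇒ p (S ∘ suc) (f ∘ suc) (m+n≡0⇒n≡0 (if S 0 then f 0 else 0) Σ≡0) i i<p Si

pinnedSum-zero : ∀ p S → pinnedSum p S (λ _ → 0) ≡ 0
pinnedSum-zero zero    S = refl
pinnedSum-zero (suc p) S with S 0
... | true  = pinnedSum-zero p (S ∘ suc)
... | false = pinnedSum-zero p (S ∘ suc)

Pinned⇒∈-compositions : ∀ {n p S f} {u : Vec ℕ p} → sum u ≡ n → Pinned p S f u → u ∈ compositions n p S f
Pinned⇒∈-compositions {p = p} {S} {f} {u} refl = ∈-compositions⁺ p S f u

-- Subsets of {0,…,l-1}, with membership read off at natural-number indices.

atB : ∀ {l} → Subset l → ℕ → Bool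
atB []      _       = false
atB (b ∷ S) zero    = b
atB (b ∷ S) (suc i) = atB S i

atB⇒< : ∀ {l} (S : Subset l) i → atB S i ≡ true → i < l
atB⇒< (b ∷ S) zero    _  = z<s
atB⇒< (b ∷ S) (suc i) Si = s≤s (atB⇒< S i Si)

atB-≥ : ∀ {l} (S : Subset l) i → l ≤ i → atB S i ≡ false
atB-≥ S i l≤i = ¬-not (λ Si → <⇒≱ (atB⇒< S i Si) l≤i)

atB-injective : ∀ {l} {S S′ : Subset l} → (∀ i → atB S i ≡ atB S′ i) → S ≡ S′
atB-injective {S = []}    {[]}      _ = refl
atB-injective {S = b ∷ S} {b′ ∷ S′} e = cong₂ _∷_ (e 0) (atB-injective (e ∘ suc))

count-atB : ∀ {l} p (S : Subset l) → l ≤ p → count p (atB S) ≡ count l (atB S)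
count-atB {l} p S l≤p = count-beyond l p (atB S) l≤p (atB-≥ S)

free≡∸count : ∀ p P → free p P ≡ p ∸ count p P
free≡∸count p P = trans (sym (m+n∸m≡n (count p P) _)) (cong (_∸ count p P) (count-complement p P))

free-atB : ∀ {l} p (S : Subset l) → l ≤ p → free p (atB S) ≡ p ∸ count l (atB S)
free-atB p S l≤p = trans (free≡∸count p (atB S)) (cong (p ∸_) (count-atB p S l≤p))

allSubsets : (l : ℕ) → List (Subset l)
allSubsets zero    = [] ∷ []
allSubsets (suc l) = map (true ∷_) (allSubsets l) ++ map (false ∷_) (allSubsets l)

∈-allSubsets : ∀ {l} (S : Subset l) → S ∈ allSubsets l
∈-allSubsets []                = here refl
∈-allSubsets {suc l} (true ∷ S)  = ∈-++⁺ˡ (∈-map⁺ _ (∈-allSubsets S))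
∈-allSubsets {suc l} (false ∷ S) = ∈-++⁺ʳ (map (true ∷_) (allSubsets l)) (∈-map⁺ _ (∈-allSubsets S))

length-allSubsets : ∀ l → length (allSubsets l) ≡ 2 ^ l
length-allSubsets zero    = refl
length-allSubsets (suc l) = begin
  length (map (true ∷_) (allSubsets l) ++ map (false ∷_) (allSubsets l))  ≡⟨ length-++ (map (true ∷_) (allSubsets l)) ⟩
  length (map (true ∷_) (allSubsets l)) + length (map (false ∷_) (allSubsets l))
    ≡⟨ cong₂ _+_ (length-map _ (allSubsets l)) (length-map _ (allSubsets l)) ⟩
  length (allSubsets l) + length (allSubsets l)                           ≡⟨ cong (λ m → m + m) (length-allSubsets l) ⟩
  2 ^ l + 2 ^ l                                                          ≡⟨ cong (2 ^ l +_) (+-identityʳ (2 ^ l)) ⟨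
  2 ^ suc l                                                              ∎
  where open ≡-Reasoning

hasSize? : ∀ {l} t (S : Subset l) → Dec (count l (atB S) ≡ t)
hasSize? {l} t S = count l (atB S) ≟ t

subsetsOfSize : (l t : ℕ) → List (Subset l)
subsetsOfSize l t = filter (hasSize? t) (allSubsets l)

length-subsetsOfSize : ∀ l t → length (subsetsOfSize l t) ≤ 2 ^ l
length-subsetsOfSize l t = ≤-trans (length-filter _ (allSubsets l)) (≤-reflexive (length-allSubsets l))

∈-subsetsOfSize⁺ : ∀ {l t} (S : Subset l) → count l (atB S) ≡ t → S ∈ subsetsOfSize l t
∈-subsetsOfSize⁺ {t = t} S = ∈-filter⁺ (hasSize? t) (∈-allSubsets S)

∈-subsetsOfSize⁻ : ∀ {l t S} → S ∈ subsetsOfSize l t → count l (atB S) ≡ t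
∈-subsetsOfSize⁻ {l} {t} = proj₂ ∘ ∈-filter⁻ (hasSize? t) {xs = allSubsets l}

subsetOfSize : ∀ l P t → t ≤ count l P → Σ (Subset l) λ S → count l (atB S) ≡ t × (∀ i → atB S i ≡ true → P i ≡ true)
subsetOfSize zero P zero _ = [] , refl , λ i ()
subsetOfSize (suc l) P t t≤ with P 0 in P0
subsetOfSize (suc l) P zero _ | _ with subsetOfSize l (P ∘ suc) 0 z≤n
... | S , ∣S∣ , S⊆P = false ∷ S , ∣S∣ , λ { zero () ; (suc i) → S⊆P i }
subsetOfSize (suc l) P (suc t) (s≤s t≤) | true with subsetOfSize l (P ∘ suc) t t≤
... | S , ∣S∣ , S⊆P = true ∷ S , cong suc ∣S∣ , λ { zero _ → P0 ; (suc i) → S⊆P i }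
subsetOfSize (suc l) P (suc t) t≤ | false with subsetOfSize l (P ∘ suc) (suc t) t≤
... | S , ∣S∣ , S⊆P = false ∷ S , ∣S∣ , λ { zero () ; (suc i) → S⊆P i }

distinct-same-size : ∀ {l} (S S′ : Subset l) → count l (atB S) ≡ count l (atB S′) → S ≢ S′ →
                     Σ ℕ λ i → i < l × atB S′ i ≡ true × atB S i ≡ false
distinct-same-size {l} S S′ ∣S∣≡∣S′∣ S≢S′ with anyUpTo? (λ i → (atB S′ i Bool.≟ true) ×-dec (atB S i Bool.≟ false)) l
... | yes (i , i<l , S′i , Si) = i , i<l , S′i , Si
... | no  ∄ = ⊥-elim (S≢S′ (atB-injective S≡S′))
  where
  S′⊆S : ∀ i → i < l → atB S′ i ≡ true → atB S i ≡ true
  S′⊆S i i<l S′i with atB S i in Si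
  ... | true  = refl
  ... | false = ⊥-elim (∄ (i , i<l , S′i , Si))
  S⊆S′ : ∀ i → i < l → atB S i ≡ true → atB S′ i ≡ true
  S⊆S′ = ⊆∧count-≥⇒⊇ l S′⊆S (≤-reflexive ∣S∣≡∣S′∣)
  S≡S′ : ∀ i → atB S i ≡ atB S′ i
  S≡S′ i with atB S i in Si | atB S′ i in S′i
  ... | true  | true  = refl
  ... | false | false = refl
  ... | true  | false = sym (trans (sym S′i) (S⊆S′ i (atB⇒< S i Si) Si))
  ... | false | true  = trans (sym Si) (S′⊆S i (atB⇒< S′ i S′i) S′i)

length-compositions-atB : ∀ {l} n p (S : Subset l) f → l ≤ p →
  length (compositions n p (atB S) f) ≡ completions n (pinnedSum p (atB S) f) (p ∸ count l (atB S))
length-compositions-atB n p S f l≤p =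
  trans (length-compositions n p (atB S) f) (cong (completions n (pinnedSum p (atB S) f)) (free-atB p S l≤p))

ZeroOn : ∀ {l p} → Subset l → Vec ℕ p → Set
ZeroOn S u = ∀ i → atB S i ≡ true → at u i ≡ 0

∣∣≡count : ∀ {l} (T : Subset l) → ∣ T ∣ ≡ count l (atB T)
∣∣≡count []          = refl
∣∣≡count (true ∷ T)  = cong suc (∣∣≡count T)
∣∣≡count (false ∷ T) = ∣∣≡count T

∈ₛ⇒atB : ∀ {l} (T : Subset l) i → i ∈ₛ T → atB T (toℕ i) ≡ true
∈ₛ⇒atB (_ ∷ T) fzero    here       = refl
∈ₛ⇒atB (_ ∷ T) (fsuc i) (there i∈) = ∈ₛ⇒atB T i i∈

atB⇒∈ₛ : ∀ {l} (T : Subset l) i (Ti : atB T i ≡ true) → fromℕ< (atB⇒< T i Ti) ∈ₛ T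
atB⇒∈ₛ (true ∷ T) zero    refl = here
atB⇒∈ₛ (_ ∷ T)    (suc i) Ti   = there (atB⇒∈ₛ T i Ti)

ZeroOn⇔ : ∀ {l p} (T : Subset l) (u : Vec ℕ p) → ZeroOn T u ⇔ ((i : Fin l) → i ∈ₛ T → at u (toℕ i) ≡ 0)
ZeroOn⇔ T u = mk⇔ (λ zero-on i i∈ → zero-on (toℕ i) (∈ₛ⇒atB T i i∈))
                  (λ zero-on i Ti → subst (λ j → at u j ≡ 0) (toℕ-fromℕ< (atB⇒< T i Ti)) (zero-on _ (atB⇒∈ₛ T i Ti)))

-- Agreement and kernels

agreeᵇ : ∀ {p q} → Vec ℕ p → Vec ℕ q → ℕ → Bool
agreeᵇ a b i = at a i ≡ᵇ at b i

agreeᵇ⇒≡ : ∀ {p q} (a : Vec ℕ p) (b : Vec ℕ q) i → agreeᵇ a b i ≡ true → at a i ≡ at b i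
agreeᵇ⇒≡ a b i = ≡ᵇ≡true⇒≡ (at a i) (at b i)

≡⇒agreeᵇ : ∀ {p q} (a : Vec ℕ p) (b : Vec ℕ q) i → at a i ≡ at b i → agreeᵇ a b i ≡ true
≡⇒agreeᵇ a b i a≡b = Equivalence.to T-≡ (≡⇒≡ᵇ (at a i) (at b i) a≡b)

agreements : ∀ {p q} → ℕ → Vec ℕ p → Vec ℕ q → ℕ
agreements l a b = count l (agreeᵇ a b)

CrossAgreeing : ∀ {p q} (l t : ℕ) → List (Vec ℕ p) → List (Vec ℕ q) → Set
CrossAgreeing l t A B = ∀ {a b} → a ∈ A → b ∈ B → t ≤ agreements l a b

AgreeOn : ∀ {l p q} → Subset l → Vec ℕ p → Vec ℕ q → Set
AgreeOn S a b = ∀ i → atB S i ≡ true → at a i ≡ at b i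

agreeOn? : ∀ {l p q} (S : Subset l) (a : Vec ℕ p) (b : Vec ℕ q) → Dec (AgreeOn S a b)
agreeOn? {l} S a b =
  map′ (λ ag i Si → ag {i} (atB⇒< S i Si) Si) (λ ag {i} _ → ag i)
       (allUpTo? (λ i → (atB S i Bool.≟ true) →-dec (at a i ≟ at b i)) l)

record Kernel {q} (l t : ℕ) (B : List (Vec ℕ q)) (b0 : Vec ℕ q) : Set where
  field
    set    : Subset l
    size   : count l (atB set) ≡ t
    agrees : ∀ {b} → b ∈ B → AgreeOn set b b0

-- only the witnesses for t-sets S carry information
NoKernel : ∀ {q} (l t : ℕ) → List (Vec ℕ q) → Vec ℕ q → Set
NoKernel {q} l t B b0 = (S : Subset l) → Σ (Vec ℕ q) λ y → y ∈ B × (count l (atB S) ≡ t → ¬ AgreeOn S y b0)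

kernel-or-noKernel : ∀ {q} l t {B : List (Vec ℕ q)} {b0} → b0 ∈ B → Kernel l t B b0 ⊎ NoKernel l t B b0
kernel-or-noKernel l t {B} {b0} b0∈B with any? (λ S → hasSize? t S ×-dec all? (λ b → agreeOn? S b b0) B) (allSubsets l)
... | yes ∃S with find ∃S
...   | S , _ , ∣S∣ , all-agree = inj₁ record { set = S ; size = ∣S∣ ; agrees = All.lookup all-agree }
kernel-or-noKernel l t {B} {b0} b0∈B | no ∄S = inj₂ witness
  where
  witness : NoKernel l t B b0
  witness S with hasSize? t S
  ... | no ∣S∣≢t = b0 , b0∈B , λ ∣S∣≡t → contradiction ∣S∣≡t ∣S∣≢t
  ... | yes ∣S∣≡t with all? (λ b → agreeOn? S b b0) B
  ...   | yes all-agree = contradiction (lose (∈-allSubsets S) (∣S∣≡t , all-agree)) ∄S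
  ...   | no ¬all-agree with find (¬All⇒Any¬ (λ b → agreeOn? S b b0) B ¬all-agree)
  ...     | y , y∈B , ¬ag = y , y∈B , λ _ → ¬ag

kernel-bound : ∀ {l p} n (A : List (Vec ℕ p)) (S : Subset l) (a0 : Vec ℕ p) → l ≤ p → Unique A →
  (∀ {a} → a ∈ A → sum a ≡ n) → (∀ {a} → a ∈ A → AgreeOn S a a0) →
  length A ≤ completions n (pinnedSum p (atB S) (at a0)) (p ∸ count l (atB S))
kernel-bound {p = p} n A S a0 l≤p A! sum≡n agree =
  ≤-trans (Unique∧⊆⇒length≤ A! (λ a∈ → Pinned⇒∈-compositions (sum≡n a∈) (λ i _ → agree a∈ i)))
          (≤-reflexive (length-compositions-atB n p S (at a0) l≤p))

-- each b agrees with a0 on some t-set, which pins b to one of 2^l sets of compositions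
agreeing-bound : ∀ {p q} l t m K (a0 : Vec ℕ p) → l ≤ q → q ∸ t ≡ suc K → (B : List (Vec ℕ q)) → Unique B →
  (∀ {b} → b ∈ B → sum b ≡ m) → (∀ {b} → b ∈ B → t ≤ agreements l b a0) → length B ≤ 2 ^ l * ∣P∣ m (suc K)
agreeing-bound {q = q} l t m K a0 l≤q q∸t≡1+K B B! sum≡m agree = begin
  length B                                        ≤⟨ Unique∧⊆⇒length≤ B! B⊆ ⟩
  length (concatMap pinnedTo (subsetsOfSize l t)) ≤⟨ length-concatMap≤ pinnedTo _ _ length-pinnedTo ⟩
  length (subsetsOfSize l t) * ∣P∣ m (suc K)       ≤⟨ *-monoˡ-≤ _ (length-subsetsOfSize l t) ⟩
  2 ^ l * ∣P∣ m (suc K)                            ∎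
  where
  open ≤-Reasoning
  pinnedTo : Subset l → List (Vec ℕ q)
  pinnedTo S = compositions m q (atB S) (at a0)
  length-pinnedTo : ∀ S → S ∈ subsetsOfSize l t → length (pinnedTo S) ≤ ∣P∣ m (suc K)
  length-pinnedTo S S∈ = ≤-trans
    (≤-reflexive (trans (length-compositions-atB m q S (at a0) l≤q)
                        (cong (completions m σ) (trans (cong (q ∸_) (∈-subsetsOfSize⁻ S∈)) q∸t≡1+K))))
    (completions-≤ m σ K)
    where σ = pinnedSum q (atB S) (at a0)
  B⊆ : B ⊆ concatMap pinnedTo (subsetsOfSize l t)
  B⊆ {b} b∈ with subsetOfSize l (agreeᵇ b a0) t (agree b∈)
  ... | S , ∣S∣ , S⊆ = ∈-concatMap pinnedTo (∈-subsetsOfSize⁺ S ∣S∣)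
                         (Pinned⇒∈-compositions (sum≡m b∈) (λ i _ Si → agreeᵇ⇒≡ b a0 i (S⊆ i Si)))

inside∧agreements≥⇒AgreeOn : ∀ {l p q} (a : Vec ℕ p) (b : Vec ℕ q) (S : Subset l) →
  count l (atB S) ≤ agreements l a b → (∀ i → i < l → at a i ≡ at b i → atB S i ≡ true) → AgreeOn S a b
inside∧agreements≥⇒AgreeOn {l} a b S ∣S∣≤ inside i Si =
  agreeᵇ⇒≡ a b i (⊆∧count-≥⇒⊇ l (λ j j<l → inside j j<l ∘ agreeᵇ⇒≡ a b j) ∣S∣≤ i (atB⇒< S i Si) Si)

-- the compositions pinned to b0 on a t-set S and to y S at one further coordinate i < l
module Candidates {q} (l t n p : ℕ) (b0 : Vec ℕ q) (y : Subset l → Vec ℕ q) where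

  pinnedOn : Subset l → ℕ → ℕ → Bool
  pinnedOn S i x = atB S x ∨ (x ≡ᵇ i)

  pins : Subset l → ℕ → ℕ → ℕ
  pins S i x = if x ≡ᵇ i then at (y S) x else at b0 x

  outside : Subset l → List ℕ
  outside S = filter (λ i → atB S i Bool.≟ false) (upTo l)

  candidatesAt : Subset l → List (Vec ℕ p)
  candidatesAt S = concatMap (λ i → compositions n p (pinnedOn S i) (pins S i)) (outside S)

  candidates : List (Vec ℕ p)
  candidates = concatMap candidatesAt (subsetsOfSize l t)

  length-candidates : ∀ K → l ≤ p → p ∸ suc t ≡ suc K → length candidates ≤ 2 ^ l * (l * ∣P∣ n (suc K))
  length-candidates K l≤p p∸1+t≡1+K = begin
    length candidates                               ≤⟨ length-concatMap≤ candidatesAt _ _ length-candidatesAt ⟩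
    length (subsetsOfSize l t) * (l * ∣P∣ n (suc K)) ≤⟨ *-monoˡ-≤ _ (length-subsetsOfSize l t) ⟩
    2 ^ l * (l * ∣P∣ n (suc K))                      ∎
    where
    open ≤-Reasoning
    length-pinned : ∀ S → S ∈ subsetsOfSize l t → ∀ i → i ∈ upTo l × atB S i ≡ false →
                    length (compositions n p (pinnedOn S i) (pins S i)) ≤ ∣P∣ n (suc K)
    length-pinned S S∈ i (i∈ , Si) = ≤-trans
      (≤-reflexive (trans (length-compositions n p (pinnedOn S i) (pins S i)) (cong (completions n σ) free≡1+K)))
      (completions-≤ n σ K)
      where
      σ = pinnedSum p (pinnedOn S i) (pins S i)
      count≡1+t : count p (pinnedOn S i) ≡ suc t
      count≡1+t = trans (count-insert p (atB S) i (≤-trans (∈-upTo⁻ i∈) l≤p) Si)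
                        (cong suc (trans (count-atB p S l≤p) (∈-subsetsOfSize⁻ S∈)))
      free≡1+K : free p (pinnedOn S i) ≡ suc K
      free≡1+K = trans (free≡∸count p (pinnedOn S i)) (trans (cong (p ∸_) count≡1+t) p∸1+t≡1+K)
    length-candidatesAt : ∀ S → S ∈ subsetsOfSize l t → length (candidatesAt S) ≤ l * ∣P∣ n (suc K)
    length-candidatesAt S S∈ =
      ≤-trans (length-concatMap≤ _ (outside S) _ (λ i i∈ → length-pinned S S∈ i (∈-filter⁻ _ i∈)))
              (*-monoˡ-≤ _ (≤-trans (length-filter _ (upTo l)) (≤-reflexive (length-upTo l))))

  ∈-candidates : ∀ {a : Vec ℕ p} S i → sum a ≡ n → count l (atB S) ≡ t → AgreeOn S a b0 →
                 i < l → atB S i ≡ false → at a i ≡ at (y S) i → a ∈ candidates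
  ∈-candidates {a} S i sum≡n ∣S∣ a≡b0 i<l Si a≡y =
    ∈-concatMap candidatesAt (∈-subsetsOfSize⁺ S ∣S∣)
      (∈-concatMap _ (∈-filter⁺ _ (∈-upTo⁺ i<l) Si) (Pinned⇒∈-compositions sum≡n pinned))
    where
    pinned : Pinned p (pinnedOn S i) (pins S i) a
    pinned x _ Px with x ≡ᵇ i in x≡ᵇi
    ... | true  = subst (λ z → at a z ≡ at (y S) z) (sym (≡ᵇ≡true⇒≡ x i x≡ᵇi)) a≡y
    ... | false = a≡b0 x (trans (sym (∨-identityʳ (atB S x))) Px)

-- Each a ∈ A agrees with b0 on some t-set S, and also outside S with the member y S of B that
-- disagrees with b0 on S: otherwise its ≥ t agreements with y S all lie in S, forcing y S = b0 on S.
noKernel-bound : ∀ {p q} l t n K {B : List (Vec ℕ q)} {b0} → b0 ∈ B → NoKernel l t B b0 →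
  l ≤ p → p ∸ suc t ≡ suc K → (A : List (Vec ℕ p)) → Unique A → (∀ {a} → a ∈ A → sum a ≡ n) →
  CrossAgreeing l t A B → length A ≤ 2 ^ l * (l * ∣P∣ n (suc K))
noKernel-bound {p} l t n K {b0 = b0} b0∈B noKernel l≤p p∸1+t≡1+K A A! sum≡n cross =
  ≤-trans (Unique∧⊆⇒length≤ A! A⊆candidates) (length-candidates K l≤p p∸1+t≡1+K)
  where
  y = proj₁ ∘ noKernel
  open Candidates l t n p b0 y
  A⊆candidates : A ⊆ candidates
  A⊆candidates {a} a∈ with subsetOfSize l (agreeᵇ a b0) t (cross a∈ b0∈B)
  ... | S , ∣S∣ , S⊆ with anyUpTo? (λ i → (at a i ≟ at (y S) i) ×-dec (atB S i Bool.≟ false)) l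
  ...   | yes (i , i<l , a≡y , Si) = ∈-candidates S i (sum≡n a∈) ∣S∣ a≡b0 i<l Si a≡y
    where
    a≡b0 : AgreeOn S a b0
    a≡b0 i Si = agreeᵇ⇒≡ a b0 i (S⊆ i Si)
  ...   | no ∄i =
    ⊥-elim (proj₂ (proj₂ (noKernel S)) ∣S∣ λ i Si → trans (sym (a≡y i Si)) (agreeᵇ⇒≡ a b0 i (S⊆ i Si)))
    where
    inside : ∀ i → i < l → at a i ≡ at (y S) i → atB S i ≡ true
    inside i i<l a≡y with atB S i in Si
    ... | true  = refl
    ... | false = ⊥-elim (∄i (i , i<l , a≡y , Si))
    a≡y : AgreeOn S a (y S)
    a≡y = inside∧agreements≥⇒AgreeOn a (y S) S
            (subst (_≤ agreements l a (y S)) (sym ∣S∣) (cross a∈ (proj₁ (proj₂ (noKernel S))))) inside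

vanishing : ∀ {l} n p → Subset l → List (Vec ℕ p)
vanishing n p T = compositions n p (atB T) (λ _ → 0)

∈-vanishing⁺ : ∀ {l n p} (T : Subset l) {u : Vec ℕ p} → sum u ≡ n → ZeroOn T u → u ∈ vanishing n p T
∈-vanishing⁺ T sum≡n zero-on = Pinned⇒∈-compositions sum≡n (λ i _ → zero-on i)

∈-vanishing⁻ : ∀ {l n p} (T : Subset l) {u : Vec ℕ p} → l ≤ p → u ∈ vanishing n p T → sum u ≡ n × ZeroOn T u
∈-vanishing⁻ {n = n} {p} T l≤p u∈ with ∈-compositions⁻ n p (atB T) (λ _ → 0) u∈
... | sum≡n , pinned = sum≡n , λ i Ti → pinned i (≤-trans (atB⇒< T i Ti) l≤p) Ti

length-vanishing : ∀ {l t} n p F (T : Subset l) → count l (atB T) ≡ t → l ≤ p → p ∸ t ≡ F →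
                   length (vanishing n p T) ≡ ∣P∣ n F
length-vanishing {l} n p F T ∣T∣ l≤p p∸t≡F = begin
  length (vanishing n p T)
    ≡⟨ length-compositions-atB n p T (λ _ → 0) l≤p ⟩
  completions n (pinnedSum p (atB T) (λ _ → 0)) (p ∸ count l (atB T))
    ≡⟨ cong₂ (completions n) (pinnedSum-zero p (atB T)) (trans (cong (p ∸_) ∣T∣) p∸t≡F) ⟩
  completions n 0 F
    ≡⟨ completions-zero n F ⟩
  ∣P∣ n F
    ∎
  where open ≡-Reasoning

module _ {l t p} n K (A : List (Vec ℕ p)) (A! : Unique A) (sum≡n : ∀ {a} → a ∈ A → sum a ≡ n)
         (l≤p : l ≤ p) (p∸t≡2+K : p ∸ t ≡ 2 + K) (a0 : Vec ℕ p) (kernel : Kernel l t A a0) where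

  open Kernel kernel renaming (set to S; size to ∣S∣; agrees to agree)

  private
    σ = pinnedSum p (atB S) (at a0)

    length≤completions : length A ≤ completions n σ (2 + K)
    length≤completions = subst (λ F → length A ≤ completions n σ F) (trans (cong (p ∸_) ∣S∣) p∸t≡2+K)
                           (kernel-bound n A S a0 l≤p A! sum≡n agree)

  kernel-family-≤ : length A ≤ ∣P∣ n (2 + K)
  kernel-family-≤ = ≤-trans length≤completions (completions-≤ n σ (suc K))

  -- equality forces the kernel values to vanish, and then A is all of vanishing n p S
  kernel-family-≡ : length A ≡ ∣P∣ n (2 + K) → ∀ u → u ∈ A ⇔ (sum u ≡ n × ZeroOn S u)
  kernel-family-≡ length≡ u = mk⇔ (λ u∈ → sum≡n u∈ , λ i Si → trans (agree u∈ i Si) (a0-zero i Si))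
                                  (λ (sum≡ , zero-on) → vanishing⊆A (∈-vanishing⁺ S sum≡ zero-on))
    where
    σ≡0 : σ ≡ 0
    σ≡0 with σ ≟ 0
    ... | yes σ≡0 = σ≡0
    ... | no  σ≢0 = ⊥-elim (<⇒≢ (≤-<-trans length≤completions (completions-< n σ K (n≢0⇒n>0 σ≢0))) length≡)
    a0-zero : ZeroOn S a0
    a0-zero i Si = pinnedSum≡0⇒ p (atB S) (at a0) σ≡0 i (≤-trans (atB⇒< S i Si) l≤p) Si
    A⊆vanishing : A ⊆ vanishing n p S
    A⊆vanishing u∈ = ∈-vanishing⁺ S (sum≡n u∈) (λ i Si → trans (agree u∈ i Si) (a0-zero i Si))
    vanishing⊆A : vanishing n p S ⊆ A
    vanishing⊆A = Unique∧⊆∧length≥⇒⊇ (Vec.≡-dec _≟_) A! A⊆vanishing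
                    (≤-reflexive (trans (length-vanishing n p (2 + K) S ∣S∣ l≤p p∸t≡2+K) (sym length≡)))

empty-or-member : ∀ {q} l t (B : List (Vec ℕ q)) →
                  B ≡ [] ⊎ Σ (Vec ℕ q) λ b0 → b0 ∈ B × (Kernel l t B b0 ⊎ NoKernel l t B b0)
empty-or-member l t []       = inj₁ refl
empty-or-member l t (b0 ∷ B) = inj₂ (b0 , here refl , kernel-or-noKernel l t (here refl))

split-member : ∀ {q l t} {B : List (Vec ℕ q)} → Σ (Vec ℕ q) (λ b0 → b0 ∈ B × (Kernel l t B b0 ⊎ NoKernel l t B b0)) →
               (Σ (Vec ℕ q) λ b0 → b0 ∈ B × NoKernel l t B b0) ⊎ (Σ (Vec ℕ q) λ b0 → b0 ∈ B × Kernel l t B b0)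
split-member (b0 , b0∈ , inj₁ kernel)   = inj₂ (b0 , b0∈ , kernel)
split-member (b0 , b0∈ , inj₂ noKernel) = inj₁ (b0 , b0∈ , noKernel)

-- Separating pairs

fromFunction : (p : ℕ) → (ℕ → ℕ) → Vec ℕ p
fromFunction zero    h = []
fromFunction (suc p) h = h 0 ∷ fromFunction p (h ∘ suc)

at-fromFunction : ∀ p h i → i < p → at (fromFunction p h) i ≡ h i
at-fromFunction (suc p) h zero    _         = refl
at-fromFunction (suc p) h (suc i) (s≤s i<p) = at-fromFunction p (λ x → h (suc x)) i i<p

sum-fromFunction-≤ : ∀ p (h : ℕ → ℕ) c → (∀ x → h x ≤ c) → sum (fromFunction p h) ≤ p * c
sum-fromFunction-≤ zero    h c _   = z≤n
sum-fromFunction-≤ (suc p) h c h≤c = +-mono-≤ (h≤c 0) (sum-fromFunction-≤ p (λ x → h (suc x)) c (λ x → h≤c (suc x)))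

sum-fromFunction-update : ∀ p (h : ℕ → ℕ) i R → i < p →
  sum (fromFunction p (λ x → if x ≡ᵇ i then R else h x)) ≡ R + sum (fromFunction p (λ x → if x ≡ᵇ i then 0 else h x))
sum-fromFunction-update (suc p) h zero    R _         = refl
sum-fromFunction-update (suc p) h (suc i) R (s≤s i<p) =
  trans (cong (h 0 +_) (sum-fromFunction-update p (h ∘ suc) i R i<p)) (x∙yz≈y∙xz (h 0) R _)

record Separating {l} (S : Subset l) (i* c p n : ℕ) : Set where
  field
    vector      : Vec ℕ p
    sum≡        : sum vector ≡ n
    zero-on     : ZeroOn S vector
    positive-at : 1 ≤ at vector i*
    constant    : ∀ x → x < l → atB S x ≡ false → x ≢ i* → at vector x ≡ c

  positive-off : 1 ≤ c → ∀ x → x < l → atB S x ≡ false → 1 ≤ at vector x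
  positive-off 1≤c x x<l Sx with x ≟ i*
  ... | yes refl = positive-at
  ... | no  x≢i* = subst (1 ≤_) (sym (constant x x<l Sx x≢i*)) 1≤c

separating : ∀ {l} (S : Subset l) i* → atB S i* ≡ false → i* < l → ∀ c p n → l ≤ p → p * c < n → Separating S i* c p n
separating {l} S i* Si* i*<l c p n l≤p pc<n = record
  { vector      = u
  ; sum≡        = trans (sum-fromFunction-update p base i* R (≤-trans i*<l l≤p)) (m∸n+n≡m (<⇒≤ s<n))
  ; zero-on     = zero-on
  ; positive-at = subst (1 ≤_) (sym (trans (at-u i* i*<l) (cong (if_then R else base i*) (≡ᵇ-refl i*))))
                         (m<n⇒0<n∸m s<n)
  ; constant    = constant
  }
  where
  base : ℕ → ℕ
  base x = if atB S x then 0 else c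
  rest : ℕ → ℕ
  rest x = if x ≡ᵇ i* then 0 else base x
  rest≤c : ∀ x → rest x ≤ c
  rest≤c x with x ≡ᵇ i* | atB S x
  ... | true  | _     = z≤n
  ... | false | true  = z≤n
  ... | false | false = ≤-refl
  s<n : sum (fromFunction p rest) < n
  s<n = ≤-<-trans (sum-fromFunction-≤ p rest c rest≤c) pc<n
  R = n ∸ sum (fromFunction p rest)
  h : ℕ → ℕ
  h x = if x ≡ᵇ i* then R else base x
  u = fromFunction p h
  at-u : ∀ x → x < l → at u x ≡ h x
  at-u x x<l = at-fromFunction p h x (≤-trans x<l l≤p)
  zero-on : ZeroOn S u
  zero-on x Sx with x ≡ᵇ i* in x≡ᵇi*
  ... | true  = ⊥-elim (false≢true (trans (sym Si*) (subst (λ z → atB S z ≡ true) (≡ᵇ≡true⇒≡ x i* x≡ᵇi*) Sx)))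
  ... | false = trans (at-u x (atB⇒< S x Sx)) h≡0
    where
    h≡0 : h x ≡ 0
    h≡0 rewrite x≡ᵇi* | Sx = refl
  constant : ∀ x → x < l → atB S x ≡ false → x ≢ i* → at u x ≡ c
  constant x x<l Sx x≢i* with x ≡ᵇ i* in x≡ᵇi*
  ... | true  = ⊥-elim (x≢i* (≡ᵇ≡true⇒≡ x i* x≡ᵇi*))
  ... | false = trans (at-u x x<l) h≡c
    where
    h≡c : h x ≡ c
    h≡c rewrite x≡ᵇi* | Sx = refl

-- Off S ∪ S′ the two vectors take the values 1 and 2, and on the symmetric difference one of them is 0
-- while the other is positive; so they agree only on S ∩ S′, which misses a point of S.
separated-pair : ∀ {l t} (S S′ : Subset l) → count l (atB S) ≡ t → count l (atB S′) ≡ t → S ≢ S′ →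
  ∀ p q n m → l ≤ p → l ≤ q → p * 1 < n → q * 2 < m →
  Σ (Vec ℕ p) λ u → Σ (Vec ℕ q) λ v → sum u ≡ n × ZeroOn S u × sum v ≡ m × ZeroOn S′ v × agreements l u v < t
separated-pair {l} {t} S S′ ∣S∣ ∣S′∣ S≢S′ p q n m l≤p l≤q p<n 2q<m
  with distinct-same-size S S′ (trans ∣S∣ (sym ∣S′∣)) S≢S′ | distinct-same-size S′ S (trans ∣S′∣ (sym ∣S∣)) (S≢S′ ∘ sym)
... | i₀ , i₀<l , S′i₀ , Si₀ | i₁ , i₁<l , Si₁ , S′i₁ =
  U.vector , V.vector , U.sum≡ , U.zero-on , V.sum≡ , V.zero-on , agreements<t
  where
  module U = Separating (separating S  i₀ Si₀  i₀<l 1 p n l≤p p<n)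
  module V = Separating (separating S′ i₁ S′i₁ i₁<l 2 q m l≤q 2q<m)

  agree⇒both : ∀ x → x < l → agreeᵇ U.vector V.vector x ≡ true → (atB S x ∧ atB S′ x) ≡ true
  agree⇒both x x<l u≡ᵇv with u≡v ← agreeᵇ⇒≡ U.vector V.vector x u≡ᵇv | atB S x in Sx | atB S′ x in S′x
  ... | true  | true  = refl
  ... | true  | false = ⊥-elim (<⇒≢ (V.positive-off (s≤s z≤n) x x<l S′x) (trans (sym (U.zero-on x Sx)) u≡v))
  ... | false | true  = ⊥-elim (<⇒≢ (U.positive-off ≤-refl x x<l Sx) (trans (sym (V.zero-on x S′x)) (sym u≡v)))
  ... | false | false = ⊥-elim (1≢2 (trans (sym (U.constant x x<l Sx x≢i₀)) (trans u≡v (V.constant x x<l S′x x≢i₁))))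
    where
    1≢2 : 1 ≢ 2
    1≢2 ()
    x≢i₀ : x ≢ i₀
    x≢i₀ refl = false≢true (trans (sym S′x) S′i₀)
    x≢i₁ : x ≢ i₁
    x≢i₁ refl = false≢true (trans (sym Sx) Si₁)

  agreements<t : agreements l U.vector V.vector < t
  agreements<t = ≤-<-trans (count-mono l agree⇒both) (subst (count l (λ x → atB S x ∧ atB S′ x) <_) ∣S∣
    (count-mono-< l (λ x _ → ∧-fst) i₁ i₁<l Si₁ (cong₂ _∧_ Si₁ S′i₁)))
    where
    ∧-fst : ∀ {a b} → (a ∧ b) ≡ true → a ≡ true
    ∧-fst {true} _ = refl

prodF-mono-≤ : ∀ r {a b : Fin r → ℕ} → (∀ j → a j ≤ b j) → prodF r a ≤ prodF r b
prodF-mono-≤ zero    a≤b = ≤-refl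
prodF-mono-≤ (suc r) a≤b = *-mono-≤ (a≤b fzero) (prodF-mono-≤ r (a≤b ∘ fsuc))

prodF-positive : ∀ r {b : Fin r → ℕ} → (∀ j → 1 ≤ b j) → 1 ≤ prodF r b
prodF-positive zero    _     = ≤-refl
prodF-positive (suc r) 1≤b = *-mono-≤ (1≤b fzero) (prodF-positive r (1≤b ∘ fsuc))

prodF-mono-< : ∀ r {a b : Fin r → ℕ} → (∀ j → a j ≤ b j) → (∀ j → 1 ≤ b j) → ∀ j → a j < b j → prodF r a < prodF r b
prodF-mono-< (suc r) {a} {b} a≤b 1≤b fzero a<b = ≤-<-trans
  (*-monoʳ-≤ (a fzero) (prodF-mono-≤ r (a≤b ∘ fsuc)))
  (*-monoˡ-< (prodF r (b ∘ fsuc)) ⦃ >-nonZero (prodF-positive r (1≤b ∘ fsuc)) ⦄ a<b)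
prodF-mono-< (suc r) {a} {b} a≤b 1≤b (fsuc j) a<b = ≤-<-trans
  (*-monoˡ-≤ (prodF r (a ∘ fsuc)) (a≤b fzero))
  (*-monoʳ-< (b fzero) ⦃ >-nonZero (1≤b fzero) ⦄ (prodF-mono-< r (a≤b ∘ fsuc) (1≤b ∘ fsuc) j a<b))

prodF-cong : ∀ r {a b : Fin r → ℕ} → (∀ j → a j ≡ b j) → prodF r a ≡ prodF r b
prodF-cong zero    a≗b = refl
prodF-cong (suc r) a≗b = cong₂ _*_ (a≗b fzero) (prodF-cong r (a≗b ∘ fsuc))

prodF-zero : ∀ r (a : Fin r → ℕ) j → a j ≡ 0 → prodF r a ≡ 0
prodF-zero (suc r) a fzero    a≡0 rewrite a≡0 = refl
prodF-zero (suc r) a (fsuc j) a≡0 = trans (cong (a fzero *_) (prodF-zero r (a ∘ fsuc) j a≡0)) (*-zeroʳ (a fzero))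

prodF-≡⇒≡ : ∀ r {a b : Fin r → ℕ} → (∀ j → a j ≤ b j) → (∀ j → 1 ≤ b j) → prodF r a ≡ prodF r b → ∀ j → a j ≡ b j
prodF-≡⇒≡ r {a} {b} a≤b 1≤b a≡b j with a j ≟ b j
... | yes aj≡bj = aj≡bj
... | no  aj≢bj = ⊥-elim (<⇒≢ (prodF-mono-< r a≤b 1≤b j (≤∧≢⇒< (a≤b j) aj≢bj)) a≡b)

scaleAt : ∀ {r} → Fin r → ℕ → (Fin r → ℕ) → Fin r → ℕ
scaleAt k c z i = if does (i ≟ᶠ k) then c * z i else z i

prodF-scaleAt : ∀ r (k : Fin r) c z → prodF r (scaleAt k c z) ≡ c * prodF r z
prodF-scaleAt (suc r) fzero    c z = *-assoc c (z fzero) _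
prodF-scaleAt (suc r) (fsuc k) c z = begin
  z fzero * prodF r (scaleAt k c (z ∘ fsuc))  ≡⟨ cong (z fzero *_) (prodF-scaleAt r k c (z ∘ fsuc)) ⟩
  z fzero * (c * prodF r (z ∘ fsuc))          ≡⟨ *-assoc (z fzero) c _ ⟨
  z fzero * c * prodF r (z ∘ fsuc)            ≡⟨ cong (_* prodF r (z ∘ fsuc)) (*-comm (z fzero) c) ⟩
  c * z fzero * prodF r (z ∘ fsuc)            ≡⟨ *-assoc c (z fzero) _ ⟩
  c * (z fzero * prodF r (z ∘ fsuc))          ∎
  where open ≡-Reasoning

prodF-<-transfer : ∀ r {x f : Fin r → ℕ} (k j : Fin r) c → j ≢ k → (∀ i → 1 ≤ f i) →
  x k ≤ c * f k → c * x j < f j → (∀ i → i ≢ k → x i ≤ f i) → prodF r x < prodF r f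
prodF-<-transfer r {x} {f} k j c j≢k 1≤f xk≤cfk cxj<fj x≤f = begin-strict
  prodF r x               ≤⟨ prodF-mono-≤ r x≤scaled ⟩
  prodF r (scaleAt k c y) ≡⟨ prodF-scaleAt r k c y ⟩
  c * prodF r y           ≡⟨ prodF-scaleAt r j c y ⟨
  prodF r (scaleAt j c y) <⟨ prodF-mono-< r scaled≤f 1≤f j scaled<f ⟩
  prodF r f               ∎
  where
  open ≤-Reasoning
  y : Fin r → ℕ
  y i = if does (i ≟ᶠ k) then f i else x i
  x≤scaled : ∀ i → x i ≤ scaleAt k c y i
  x≤scaled i with i ≟ᶠ k
  ... | yes refl = xk≤cfk
  ... | no  _    = ≤-refl
  y-off : ∀ i → i ≢ k → y i ≡ x i
  y-off i i≢k with i ≟ᶠ k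
  ... | yes i≡k = ⊥-elim (i≢k i≡k)
  ... | no  _   = refl
  cyj<fj : c * y j < f j
  cyj<fj = subst (λ z → c * z < f j) (sym (y-off j j≢k)) cxj<fj
  scaled<f : scaleAt j c y j < f j
  scaled<f with j ≟ᶠ j
  ... | yes _   = cyj<fj
  ... | no  j≢j = ⊥-elim (j≢j refl)
  scaled≤f : ∀ i → scaleAt j c y i ≤ f i
  scaled≤f i with i ≟ᶠ j
  ... | yes refl = <⇒≤ cyj<fj
  ... | no  _ with i ≟ᶠ k
  ...   | yes refl = ≤-refl
  ...   | no  i≢k  = x≤f i i≢k

minF-≤ : ∀ r (f : Fin r → ℕ) j → minF r f ≤ f j
minF-≤ (suc zero)    f fzero    = ≤-refl
minF-≤ (suc (suc r)) f fzero    = m⊓n≤m _ _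
minF-≤ (suc (suc r)) f (fsuc j) = ≤-trans (m⊓n≤n _ _) (minF-≤ (suc r) (f ∘ fsuc) j)

sumF : (r : ℕ) → (Fin r → ℕ) → ℕ
sumF zero    f = 0
sumF (suc r) f = f fzero + sumF r (f ∘ fsuc)

≤-sumF : ∀ r (f : Fin r → ℕ) j → f j ≤ sumF r f
≤-sumF (suc r) f fzero    = m≤m+n _ _
≤-sumF (suc r) f (fsuc j) = ≤-trans (≤-sumF r (f ∘ fsuc) j) (m≤n+m _ _)

another : ∀ {r} → 2 ≤ r → (k : Fin r) → ∃ λ j → j ≢ k
another {suc zero}    (s≤s ()) fzero
another {suc (suc r)} _ fzero    = fsuc fzero , λ ()
another {suc (suc r)} _ (fsuc k) = fzero , λ ()

∃-or-∀ : ∀ {r} {P Q : Fin r → Set} → (∀ j → P j ⊎ Q j) → (∃ P) ⊎ (∀ j → Q j)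
∃-or-∀ {zero}  _     = inj₂ λ ()
∃-or-∀ {suc r} P⊎Q with P⊎Q fzero | ∃-or-∀ (P⊎Q ∘ fsuc)
... | inj₁ P0       | _               = inj₁ (fzero , P0)
... | inj₂ _        | inj₁ (j , Pj)   = inj₁ (fsuc j , Pj)
... | inj₂ Q0       | inj₂ Q∘suc      = inj₂ λ { fzero → Q0 ; (fsuc j) → Q∘suc j }

module CrossIntersecting (r : ℕ) (2≤r : 2 ≤ r) (ls : Fin r → ℕ) (t : ℕ) (t+2≤l : t + 2 ≤ minF r ls) where

  l : ℕ
  l = minF r ls

  M : ℕ
  M = 2 ^ l * (2 ^ l * l)

  -- n₀ ≥ (l_j − t − 1)·M gives M·∣P∣ n (l_j − t − 1) < ∣P∣ n (l_j − t), and n₀ > 2 l_j leaves room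
  -- for separated-pair.
  n₀ : ℕ
  n₀ = sumF r ls * M + suc (2 * sumF r ls)

  -- l_j − t = 2 + K j, so that no truncated subtraction is left in the bounds
  K : Fin r → ℕ
  K j = ls j ∸ t ∸ 2

  l≤ls : ∀ j → l ≤ ls j
  l≤ls = minF-≤ r ls

  ls∸t≡2+K : ∀ j → ls j ∸ t ≡ 2 + K j
  ls∸t≡2+K j = sym (m+[n∸m]≡n (subst (_≤ ls j ∸ t) (m+n∸m≡n t 2) (∸-monoˡ-≤ t (≤-trans t+2≤l (l≤ls j)))))

  ls∸[1+t]≡1+K : ∀ j → ls j ∸ suc t ≡ 1 + K j
  ls∸[1+t]≡1+K j = trans (sym (pred[m∸n]≡m∸[1+n] (ls j) t)) (cong pred (ls∸t≡2+K j))

  first : Fin r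
  first = fromℕ< (≤-trans (s≤s z≤n) 2≤r)

  module Families (ns : Fin r → ℕ) (n₀≤ns : ∀ j → n₀ ≤ ns j) (A : (j : Fin r) → List (Vec ℕ (ls j)))
                  (A! : ∀ j → Unique (A j)) (sum≡ns : ∀ j {a} → a ∈ A j → sum a ≡ ns j)
                  (cross : (u : (j : Fin r) → Vec ℕ (ls j)) → (∀ j → u j ∈ A j) → t ≤ cardI r ls u) where

    x f : Fin r → ℕ
    x j = length (A j)
    f j = ∣P∣ (ns j) (2 + K j)

    ls*2<ns : ∀ j → ls j * 2 < ns j
    ls*2<ns j = ≤-trans (s≤s (≤-trans (*-monoˡ-≤ 2 (≤-sumF r ls j)) (≤-reflexive (*-comm (sumF r ls) 2))))
                        (≤-trans (m≤n+m _ _) (n₀≤ns j))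

    ls*1<ns : ∀ j → ls j * 1 < ns j
    ls*1<ns j = ≤-<-trans (*-monoʳ-≤ (ls j) (s≤s z≤n)) (ls*2<ns j)

    f-positive : ∀ j → 1 ≤ f j
    f-positive j = ∣P∣-positive (ns j) (suc (K j))

    Extremal : Subset l → Set
    Extremal T = ∀ j u → u ∈ A j ⇔ (sum u ≡ ns j × ZeroOn T u)

    cardI≤agreements : ∀ u j k → cardI r ls u ≤ agreements l (u j) (u k)
    cardI≤agreements u j k = ≤-trans (≤-reflexive (length-filter-applyUpTo (agree? r ls u) (λ i → i) l))
      (count-mono l (λ i _ agree → ≡⇒agreeᵇ (u j) (u k) i
                                      (does≡true⇒ (agree? r ls u i) agree j k)))

    -- fill the remaining places of an r-tuple with fixed members of the families
    pairwise : (∀ j → ∃ (_∈ A j)) → ∀ {j k} → j ≢ k → CrossAgreeing l t (A j) (A k)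
    pairwise members {j} {k} j≢k {a} {b} a∈ b∈ =
      ≤-trans (cross tuple tuple∈) (subst₂ (λ a′ b′ → cardI r ls tuple ≤ agreements l a′ b′) tuple-j tuple-k
                                            (cardI≤agreements tuple j k))
      where
      tuple : (i : Fin r) → Vec ℕ (ls i)
      tuple i with j ≟ᶠ i | k ≟ᶠ i
      ... | yes refl | _        = a
      ... | no  _    | yes refl = b
      ... | no  _    | no  _    = proj₁ (members i)
      tuple∈ : ∀ i → tuple i ∈ A i
      tuple∈ i with j ≟ᶠ i | k ≟ᶠ i
      ... | yes refl | _        = a∈
      ... | no  _    | yes refl = b∈
      ... | no  _    | no  _    = proj₂ (members i)
      tuple-j : tuple j ≡ a
      tuple-j with j ≟ᶠ j
      ... | yes refl = refl
      ... | no  j≢j  = ⊥-elim (j≢j refl)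
      tuple-k : tuple k ≡ b
      tuple-k with j ≟ᶠ k | k ≟ᶠ k
      ... | yes j≡k | _        = ⊥-elim (j≢k j≡k)
      ... | no  _   | yes refl = refl
      ... | no  _   | no  k≢k  = ⊥-elim (k≢k refl)

    data Shape : Set where
      some-empty    : ∀ j → A j ≡ [] → Shape
      some-noKernel : (∀ j → ∃ (_∈ A j)) → ∀ k {b0} → b0 ∈ A k → NoKernel l t (A k) b0 → Shape
      all-kernel    : (∀ j → Σ (Vec ℕ (ls j)) λ a0 → a0 ∈ A j × Kernel l t (A j) a0) → Shape

    shape : Shape
    shape with ∃-or-∀ (λ j → empty-or-member l t (A j))
    ... | inj₁ (j , A≡[]) = some-empty j A≡[]
    ... | inj₂ members with ∃-or-∀ (λ j → split-member (members j))
    ...   | inj₁ (k , b0 , b0∈ , noKernel) =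
      some-noKernel (λ j → proj₁ (members j) , proj₁ (proj₂ (members j))) k b0∈ noKernel
    ...   | inj₂ kernels                   = all-kernel kernels

    -- A_k exceeds its bound by a factor of at most 2^l, and every other family is smaller than its
    -- bound by a factor of more than 2^l.
    noKernel-case : (∀ j → ∃ (_∈ A j)) → ∀ k {b0} → b0 ∈ A k → NoKernel l t (A k) b0 → prodF r x < prodF r f
    noKernel-case members k b0∈ noKernel =
      prodF-<-transfer r k j₀ (2 ^ l) j₀≢k f-positive xk≤
        (≤-<-trans (*-monoʳ-≤ (2 ^ l) (small j₀ j₀≢k)) (2^l*tiny<f j₀))
        (λ i i≢k → ≤-trans (small i i≢k) (≤-trans (m≤n*m _ (2 ^ l) ⦃ m^n≢0 2 l ⦄) (<⇒≤ (2^l*tiny<f i))))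
      where
      j₀ = proj₁ (another 2≤r k)
      j₀≢k = proj₂ (another 2≤r k)
      tiny : Fin r → ℕ
      tiny j = 2 ^ l * (l * ∣P∣ (ns j) (suc (K j)))
      small : ∀ j → j ≢ k → x j ≤ tiny j
      small j j≢k = noKernel-bound l t (ns j) (K j) b0∈ noKernel (l≤ls j) (ls∸[1+t]≡1+K j) (A j) (A! j) (sum≡ns j)
                      (pairwise members j≢k)
      xk≤ : x k ≤ 2 ^ l * f k
      xk≤ = agreeing-bound l t (ns k) (suc (K k)) (proj₁ (members j₀)) (l≤ls k) (ls∸t≡2+K k) (A k) (A! k) (sum≡ns k)
              (λ b∈ → pairwise members (j₀≢k ∘ sym) b∈ (proj₂ (members j₀)))
      room : ∀ j → suc (K j) * M ≤ ns j
      room j = ≤-trans (*-monoˡ-≤ M 1+K≤sumF) (≤-trans (m≤m+n _ _) (n₀≤ns j))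
        where
        1+K≤sumF : suc (K j) ≤ sumF r ls
        1+K≤sumF = ≤-trans (≤-reflexive (sym (ls∸[1+t]≡1+K j))) (≤-trans (m∸n≤m (ls j) (suc t)) (≤-sumF r ls j))
      2^l*tiny<f : ∀ j → 2 ^ l * tiny j < f j
      2^l*tiny<f j = subst (_< f j) (trans (*-assoc (2 ^ l) (2 ^ l * l) P) (cong (2 ^ l *_) (*-assoc (2 ^ l) l P)))
                       (M*P[n,1+k]<P[n,2+k] M (ns j) (K j) (room j))
        where P = ∣P∣ (ns j) (suc (K j))

    module KernelCase (kernels : ∀ j → Σ (Vec ℕ (ls j)) λ a0 → a0 ∈ A j × Kernel l t (A j) a0) where

      a0 : ∀ j → Vec ℕ (ls j)
      a0 j = proj₁ (kernels j)

      kernel : ∀ j → Kernel l t (A j) (a0 j)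
      kernel j = proj₂ (proj₂ (kernels j))

      S : Fin r → Subset l
      S j = Kernel.set (kernel j)

      ∣S∣ : ∀ j → count l (atB (S j)) ≡ t
      ∣S∣ j = Kernel.size (kernel j)

      x≤f : ∀ j → x j ≤ f j
      x≤f j = kernel-family-≤ (ns j) (K j) (A j) (A! j) (sum≡ns j) (l≤ls j) (ls∸t≡2+K j) (a0 j) (kernel j)

      module _ (x≡f : prodF r x ≡ prodF r f) where

        A≡vanishing : ∀ j u → u ∈ A j ⇔ (sum u ≡ ns j × ZeroOn (S j) u)
        A≡vanishing j = kernel-family-≡ (ns j) (K j) (A j) (A! j) (sum≡ns j) (l≤ls j) (ls∸t≡2+K j)
                          (a0 j) (kernel j) (prodF-≡⇒≡ r x≤f f-positive x≡f j)

        S≡S-first : ∀ j → S j ≡ S first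
        S≡S-first j with Vec.≡-dec Bool._≟_ (S j) (S first)
        ... | yes S≡ = S≡
        ... | no  S≢ with separated-pair (S j) (S first) (∣S∣ j) (∣S∣ first) S≢ (ls j) (ls first) (ns j) (ns first)
                            (l≤ls j) (l≤ls first) (ls*1<ns j) (ls*2<ns first)
        ...   | u , v , sum-u , zero-u , sum-v , zero-v , agreements<t =
          ⊥-elim (<⇒≱ agreements<t (pairwise (λ i → a0 i , proj₁ (proj₂ (kernels i))) (S≢ ∘ cong S)
                                       (Equivalence.from (A≡vanishing j u) (sum-u , zero-u))
                                       (Equivalence.from (A≡vanishing first v) (sum-v , zero-v))))

        extremal : Extremal (S first)
        extremal j u = subst (λ T → u ∈ A j ⇔ (sum u ≡ ns j × ZeroOn T u)) (S≡S-first j) (A≡vanishing j u)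

    bound : prodF r x ≤ prodF r f
    bound with shape
    ... | some-empty j A≡[]              = ≤-trans (≤-reflexive (prodF-zero r x j (cong length A≡[]))) z≤n
    ... | some-noKernel members k b0∈ nk = <⇒≤ (noKernel-case members k b0∈ nk)
    ... | all-kernel kernels             = prodF-mono-≤ r (KernelCase.x≤f kernels)

    equality⇒extremal : prodF r x ≡ prodF r f → Σ (Subset l) λ T → count l (atB T) ≡ t × Extremal T
    equality⇒extremal x≡f with shape
    ... | some-empty j A≡[] =
      ⊥-elim (<⇒≢ (prodF-positive r f-positive) (trans (sym (prodF-zero r x j (cong length A≡[]))) x≡f))
    ... | some-noKernel members k b0∈ nk = ⊥-elim (<⇒≢ (noKernel-case members k b0∈ nk) x≡f)
    ... | all-kernel kernels = S first , ∣S∣ first , extremal x≡f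
      where open KernelCase kernels

    extremal⇒equality : (T : Subset l) → count l (atB T) ≡ t → Extremal T → prodF r x ≡ prodF r f
    extremal⇒equality T ∣T∣ extremal = prodF-cong r λ j →
      trans (≤-antisym (Unique∧⊆⇒length≤ (A! j) (A⊆ j)) (Unique∧⊆⇒length≤ (compositions-unique _ _ _ _) (⊆A j)))
            (length-vanishing (ns j) (ls j) (2 + K j) T ∣T∣ (l≤ls j) (ls∸t≡2+K j))
      where
      A⊆ : ∀ j → A j ⊆ vanishing (ns j) (ls j) T
      A⊆ j {u} u∈ = let sum≡ , zero-on = Equivalence.to (extremal j u) u∈ in ∈-vanishing⁺ T sum≡ zero-on
      ⊆A : ∀ j → vanishing (ns j) (ls j) T ⊆ A j
      ⊆A j {u} u∈ = Equivalence.from (extremal j u) (∈-vanishing⁻ T (l≤ls j) u∈)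

  ∣P∣≡binomial : ∀ n j → ∣P∣ n (2 + K j) ≡ (n + ls j ∸ t ∸ 1) C (ls j ∸ t ∸ 1)
  ∣P∣≡binomial n j = trans (∣P∣≡C n (suc (K j))) (sym (cong₂ _C_ n+ls∸t∸1≡n+1+K (cong (_∸ 1) (ls∸t≡2+K j))))
    where
    n+ls∸t∸1≡n+1+K : n + ls j ∸ t ∸ 1 ≡ n + suc (K j)
    n+ls∸t∸1≡n+1+K = begin
      n + ls j ∸ t ∸ 1      ≡⟨ cong (_∸ 1) (+-∸-assoc n (≤-trans (m≤m+n t 2) (≤-trans t+2≤l (l≤ls j)))) ⟩
      n + (ls j ∸ t) ∸ 1    ≡⟨ cong (λ m → n + m ∸ 1) (ls∸t≡2+K j) ⟩
      n + (2 + K j) ∸ 1     ≡⟨ +-∸-assoc n (s≤s z≤n) ⟩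
      n + suc (K j)         ∎
      where open ≡-Reasoning

theorem1p3 : (r : ℕ) → 2 ≤ r → (ls : Fin r → ℕ) → (t : ℕ) → 1 ≤ t → (∀ j → 1 ≤ ls j) →
    t + 2 ≤ minF r ls →
    Σ ℕ λ n₀ → (ns : Fin r → ℕ) → (∀ j → n₀ ≤ ns j) →
    (A : (j : Fin r) → List (Vec ℕ (ls j))) →
    (∀ j → Unique (A j)) →
    (∀ j → All (λ u → sum u ≡ ns j) (A j)) →
    ((u : (j : Fin r) → Vec ℕ (ls j)) → (∀ j → u j ∈ A j) → t ≤ cardI r ls u) →
    (prodF r (λ j → length (A j)) ≤ prodF r (λ j → (ns j + ls j ∸ t ∸ 1) C (ls j ∸ t ∸ 1)))
    × ((prodF r (λ j → length (A j)) ≡ prodF r (λ j → (ns j + ls j ∸ t ∸ 1) C (ls j ∸ t ∸ 1)))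
       ⇔ (Σ (Subset (minF r ls)) λ T → ∣ T ∣ ≡ t ×
           ((j : Fin r) → (u : Vec ℕ (ls j)) →
             (u ∈ A j) ⇔ (sum u ≡ ns j × ((i : Fin (minF r ls)) → i ∈ₛ T → at u (toℕ i) ≡ 0)))))
theorem1p3 r 2≤r ls t _ _ t+2≤l = n₀ , λ ns n₀≤ns A A! sums cross →
  let open Families ns n₀≤ns A A! (λ j → All.lookup (sums j)) cross
      f≡C = prodF-cong r (λ j → ∣P∣≡binomial (ns j) j)
  in ≤-trans bound (≤-reflexive f≡C)
   , mk⇔ (λ x≡C → let T , ∣T∣ , extremal = equality⇒extremal (trans x≡C (sym f≡C))
                  in T , trans (∣∣≡count T) ∣T∣ , λ j u → (⇔-id _ ×-⇔ ZeroOn⇔ T u) ⇔-∘ extremal j u)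
         (λ (T , ∣T∣ , extremal) →
            trans (extremal⇒equality T (trans (sym (∣∣≡count T)) ∣T∣)
                    (λ j u → (⇔-id _ ×-⇔ ⇔-sym (ZeroOn⇔ T u)) ⇔-∘ extremal j u))
                  f≡C)
  where open CrossIntersecting r 2≤r ls t t+2≤l
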